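{- Let $\mathsf{K}$ be a variety, $\mathbf{B}\in\mathsf{K}$, and $\mathbf{A}\le\mathbf{B}$ fully epic in $\mathsf{K}$. Then for all congruences $\theta_1,\theta_2$ of $\mathbf{B}$, \[(\theta_1+^{\mathbf{B}}\theta_2)\cap(A\times A)=(\theta_1\cap(A\times A))+^{\mathbf{A}}(\theta_2\cap(A\times A)).\]
   Context: A variety is a class of similar algebras closed under homomorphic images, subalgebras and direct products. For an algebra $\mathbf{C}$, $+^{\mathbf{C}}$ denotes the join in the congruence lattice of $\mathbf{C}$. A subalgebra $\mathbf{A}\le\mathbf{B}$ is epic in $\mathsf{K}$ if for all $\mathbf{C}\in\mathsf{K}$ and homomorphisms $g,h\colon\mathbf{B}\to\mathbf{C}$ coinciding on $A$ we have $g=h$; it is full in $\mathsf{K}$ if it is proper, $B$ is generated by $A\cup\{b\}$ for some $b\in B$, and every congruence $\theta\ne\mathrm{id}_B$ of $\mathbf{B}$ relates every $b\in B$ to some element of $A$; it is fully epic in $\mathsf{K}$ if both epic and full in $\mathsf{K}$. -}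

module Defs where

open import Level using (Level; _⊔_) renaming (suc to lsuc)
open import Data.Nat using (ℕ)
open import Data.Fin using (Fin)
open import Data.Product using (Σ; ∃; _×_; _,_; proj₁; proj₂)
open import Data.Sum using (_⊎_)
open import Relation.Nullary using (¬_)
open import Relation.Unary using (Pred; _∈_)
open import Relation.Binary using (Rel; IsEquivalence)

record Signature : Set₁ where
  field
    Op    : Set
    arity : Op → ℕ
open Signature public

-- Algebras over setoids (carrier + equality), so that quotients B/θ exist
-- (same carrier, θ as the new equality).
record Algebra (𝑆 : Signature) (α : Level) : Set (lsuc α) where
  field
    Carrier       : Set α
    _≈_           : Rel Carrier α
    isEquivalence : IsEquivalence _≈_
    op            : (f : Op 𝑆) → (Fin (arity 𝑆 f) → Carrier) → Carrier
    op-cong       : (f : Op 𝑆) {xs ys : Fin (arity 𝑆 f) → Carrier} →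
                    (∀ i → xs i ≈ ys i) → op f xs ≈ op f ys
open Algebra public

module _ {𝑆 : Signature} {α : Level} where

  record Hom (A C : Algebra 𝑆 α) : Set α where
    field
      fun      : Carrier A → Carrier C
      fun-cong : ∀ {x y} → _≈_ A x y → _≈_ C (fun x) (fun y)
      fun-op   : (f : Op 𝑆) (xs : Fin (arity 𝑆 f) → Carrier A) →
                 _≈_ C (fun (op A f xs)) (op C f (λ i → fun (xs i)))
  open Hom public

  Surjective : {A C : Algebra 𝑆 α} → Hom A C → Set α
  Surjective {A} {C} h = ∀ (c : Carrier C) → ∃ λ (a : Carrier A) → _≈_ C (fun h a) c

  Injective : {A C : Algebra 𝑆 α} → Hom A C → Set α
  Injective {A} {C} h = ∀ {x y} → _≈_ C (fun h x) (fun h y) → _≈_ A x y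

  Product : (I : Set α) → (I → Algebra 𝑆 α) → Algebra 𝑆 α
  Product I 𝒜 = record
    { Carrier = (i : I) → Carrier (𝒜 i)
    ; _≈_ = λ x y → ∀ i → _≈_ (𝒜 i) (x i) (y i)
    ; isEquivalence = record
        { refl  = λ i → IsEquivalence.refl (isEquivalence (𝒜 i))
        ; sym   = λ p i → IsEquivalence.sym (isEquivalence (𝒜 i)) (p i)
        ; trans = λ p q i → IsEquivalence.trans (isEquivalence (𝒜 i)) (p i) (q i) }
    ; op = λ f xs i → op (𝒜 i) f (λ k → xs k i)
    ; op-cong = λ f ps i → op-cong (𝒜 i) f (λ k → ps k i)
    }

  -- A variety: a class closed under homomorphic images, subalgebras and
  -- direct products (subalgebras = algebras embedding into a member).
  record IsVariety {ρ : Level} (K : Pred (Algebra 𝑆 α) ρ) : Set (lsuc α ⊔ ρ) where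
    field
      closed-H : ∀ {A C : Algebra 𝑆 α} → A ∈ K → (h : Hom A C) → Surjective h → C ∈ K
      closed-S : ∀ {A C : Algebra 𝑆 α} → A ∈ K → (h : Hom C A) → Injective h → C ∈ K
      closed-P : ∀ (I : Set α) (𝒜 : I → Algebra 𝑆 α) → (∀ i → 𝒜 i ∈ K) → Product I 𝒜 ∈ K

  record Subuniverse (B : Algebra 𝑆 α) : Set (lsuc α) where
    field
      mem      : Pred (Carrier B) α
      mem-resp : ∀ {x y} → _≈_ B x y → mem x → mem y
      mem-op   : (f : Op 𝑆) (xs : Fin (arity 𝑆 f) → Carrier B) →
                 (∀ i → mem (xs i)) → mem (op B f xs)
  open Subuniverse public

  SubAlg : (B : Algebra 𝑆 α) → Subuniverse B → Algebra 𝑆 α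
  SubAlg B A = record
    { Carrier = Σ (Carrier B) (mem A)
    ; _≈_ = λ x y → _≈_ B (proj₁ x) (proj₁ y)
    ; isEquivalence = record
        { refl  = IsEquivalence.refl (isEquivalence B)
        ; sym   = IsEquivalence.sym (isEquivalence B)
        ; trans = IsEquivalence.trans (isEquivalence B) }
    ; op = λ f xs → op B f (λ i → proj₁ (xs i)) , mem-op A f (λ i → proj₁ (xs i)) (λ i → proj₂ (xs i))
    ; op-cong = λ f ps → op-cong B f ps
    }

  data Sg (B : Algebra 𝑆 α) (X : Pred (Carrier B) α) : Pred (Carrier B) α where
    gen  : ∀ {x} → X x → Sg B X x
    app  : (f : Op 𝑆) (xs : Fin (arity 𝑆 f) → Carrier B) →
           (∀ i → Sg B X (xs i)) → Sg B X (op B f xs)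
    resp : ∀ {x y} → _≈_ B x y → Sg B X x → Sg B X y

  record Congruence (A : Algebra 𝑆 α) : Set (lsuc α) where
    field
      rel       : Rel (Carrier A) α
      rel-equiv : IsEquivalence rel
      ≈⊆rel     : ∀ {x y} → _≈_ A x y → rel x y
      compat    : (f : Op 𝑆) {xs ys : Fin (arity 𝑆 f) → Carrier A} →
                  (∀ i → rel (xs i) (ys i)) → rel (op A f xs) (op A f ys)
  open Congruence public

  -- θ is the identity congruence id_A (θ ⊆ ≈; the converse always holds)
  IsIdentity : {A : Algebra 𝑆 α} → Congruence A → Set α
  IsIdentity {A} θ = ∀ x y → rel θ x y → _≈_ A x y

  _⊆ᶜ_ : {A : Algebra 𝑆 α} → Congruence A → Congruence A → Set α
  θ ⊆ᶜ φ = ∀ {x y} → rel θ x y → rel φ x y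

  Join : (A : Algebra 𝑆 α) → Congruence A → Congruence A → Rel (Carrier A) (lsuc α)
  Join A θ₁ θ₂ x y = (φ : Congruence A) → θ₁ ⊆ᶜ φ → θ₂ ⊆ᶜ φ → rel φ x y

  restrict : {B : Algebra 𝑆 α} (A : Subuniverse B) → Congruence B → Congruence (SubAlg B A)
  restrict {B} A θ = record
    { rel = λ x y → rel θ (proj₁ x) (proj₁ y)
    ; rel-equiv = record
        { refl  = IsEquivalence.refl (rel-equiv θ)
        ; sym   = IsEquivalence.sym (rel-equiv θ)
        ; trans = IsEquivalence.trans (rel-equiv θ) }
    ; ≈⊆rel = ≈⊆rel θ
    ; compat = λ f ps → compat θ f ps
    }

  Epic : {ρ : Level} → Pred (Algebra 𝑆 α) ρ → (B : Algebra 𝑆 α) → Subuniverse B → Set (lsuc α ⊔ ρ)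
  Epic K B A = ∀ (C : Algebra 𝑆 α) → C ∈ K → (g h : Hom B C) →
               (∀ a → mem A a → _≈_ C (fun g a) (fun h a)) →
               ∀ b → _≈_ C (fun g b) (fun h b)

  Full : {ρ : Level} → Pred (Algebra 𝑆 α) ρ → (B : Algebra 𝑆 α) → Subuniverse B → Set (lsuc α)
  Full K B A =
    (∃ λ (b : Carrier B) → ¬ mem A b)
    × (∃ λ (b : Carrier B) → ∀ x → Sg B (λ y → mem A y ⊎ _≈_ B y b) x)
    × (∀ (θ : Congruence B) → ¬ IsIdentity θ →
         ∀ (b : Carrier B) → ∃ λ (a : Carrier B) → mem A a × rel θ b a)

  FullyEpic : {ρ : Level} → Pred (Algebra 𝑆 α) ρ → (B : Algebra 𝑆 α) → Subuniverse B → Set (lsuc α ⊔ ρ)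
  FullyEpic K B A = Epic K B A × Full K B A

-- Fullness makes the logic classical: applied to the congruence that identifies
-- everything exactly when a proposition Q holds, it turns ¬ ¬ Q into Q.  So we may
-- split on whether θ₁ or θ₂ is the identity, and those cases are immediate.
-- Otherwise let ψ be a congruence of A above both restrictions.  Choosing for each
-- b ∈ B an element of A that is θᵢ-related to it gives a homomorphism
-- Gᵢ : B → A/ψ extending the quotient map of A.  By epicity G₁ = G₂, so the kernel
-- of G₁ contains both θ₁ and θ₂, hence their join, and on A that kernel is ψ.
module Submission where

open import Defs
open import Level using (Level) renaming (suc to lsuc)
open import Data.Product using (proj₁)
open import Relation.Unary using (Pred; _∈_)
open import Function.Bundles using (_⇔_)

open import Data.Nat using (zero; suc)
open import Data.Fin using (Fin; zero; suc)
open import Data.Product using (proj₂; _,_; ∃; _×_)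
open import Data.Sum using (_⊎_; inj₁; inj₂)
import Data.Sum as Sum
open import Function using (_∘_; id)
open import Function.Bundles using (mk⇔)
open import Relation.Binary using (IsEquivalence)
open import Relation.Nullary using (¬_; Dec; yes; no; ¬¬-excluded-middle; contradiction)

∀-⊎-const : ∀ {ℓ} n {P : Fin n → Set ℓ} {Q : Set ℓ} → (∀ i → P i ⊎ Q) → (∀ i → P i) ⊎ Q
∀-⊎-const zero    _ = inj₁ λ ()
∀-⊎-const (suc n) h with h zero | ∀-⊎-const n (h ∘ suc)
... | inj₂ q | _       = inj₂ q
... | inj₁ _ | inj₂ q  = inj₂ q
... | inj₁ p | inj₁ ps = inj₁ λ { zero → p ; (suc i) → ps i }

module _ {𝑆 : Signature} {α : Level} where

  Absorbing : (B : Algebra 𝑆 α) → Subuniverse B → Set (lsuc α)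
  Absorbing B A = ∀ (θ : Congruence B) → ¬ IsIdentity θ →
                  ∀ b → ∃ λ a → mem A a × rel θ b a

  _/_ : (C : Algebra 𝑆 α) → Congruence C → Algebra 𝑆 α
  C / ψ = record
    { Carrier       = Carrier C
    ; _≈_           = rel ψ
    ; isEquivalence = rel-equiv ψ
    ; op            = op C
    ; op-cong       = compat ψ
    }

  quotientHom : (C : Algebra 𝑆 α) (ψ : Congruence C) → Hom C (C / ψ)
  quotientHom C ψ = record
    { fun      = id
    ; fun-cong = ≈⊆rel ψ
    ; fun-op   = λ _ _ → IsEquivalence.refl (rel-equiv ψ)
    }

  inclusionHom : (B : Algebra 𝑆 α) (A : Subuniverse B) → Hom (SubAlg B A) B
  inclusionHom B A = record
    { fun      = proj₁
    ; fun-cong = id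
    ; fun-op   = λ _ _ → IsEquivalence.refl (isEquivalence B)
    }

  kernel : {B C : Algebra 𝑆 α} → Hom B C → Congruence B
  kernel {B} {C} G = record
    { rel       = λ x y → _≈_ C (fun G x) (fun G y)
    ; rel-equiv = record { refl = refl ; sym = sym ; trans = trans }
    ; ≈⊆rel     = fun-cong G
    ; compat    = λ f {xs} {ys} ps →
        trans (fun-op G f xs) (trans (op-cong C f ps) (sym (fun-op G f ys)))
    }
    where open IsEquivalence (isEquivalence C)

  module _ {ρ : Level} {K : Pred (Algebra 𝑆 α) ρ} (V : IsVariety K) where
    open IsVariety V

    SubAlg∈ : {B : Algebra 𝑆 α} → B ∈ K → (A : Subuniverse B) → SubAlg B A ∈ K
    SubAlg∈ B∈K A = closed-S B∈K (inclusionHom _ A) id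

    quotient∈ : {C : Algebra 𝑆 α} → C ∈ K → (ψ : Congruence C) → C / ψ ∈ K
    quotient∈ {C} C∈K ψ =
      closed-H C∈K (quotientHom C ψ) (λ c → c , IsEquivalence.refl (rel-equiv ψ))

  collapseIf : (B : Algebra 𝑆 α) → Set α → Congruence B
  collapseIf B Q = record
    { rel       = λ x y → _≈_ B x y ⊎ Q
    ; rel-equiv = record { refl = inj₁ refl ; sym = Sum.map₁ sym ; trans = trans′ }
    ; ≈⊆rel     = inj₁
    ; compat    = λ f ps → Sum.map₁ (op-cong B f) (∀-⊎-const _ ps)
    }
    where
    open IsEquivalence (isEquivalence B)
    trans′ : ∀ {x y z} → _≈_ B x y ⊎ Q → _≈_ B y z ⊎ Q → _≈_ B x z ⊎ Q
    trans′ (inj₁ p) (inj₁ q) = inj₁ (trans p q)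
    trans′ (inj₁ _) (inj₂ q) = inj₂ q
    trans′ (inj₂ q) _        = inj₂ q

  module _ {B : Algebra 𝑆 α} (A : Subuniverse B) {a b : Carrier B}
           (a∈A : mem A a) (b∉A : ¬ mem A b) (absorbing : Absorbing B A) where

    private
      b≉A : ∀ {c} → mem A c → ¬ _≈_ B b c
      b≉A c∈A b≈c = b∉A (mem-resp A (IsEquivalence.sym (isEquivalence B) b≈c) c∈A)

    absorbing⇒stable : {Q : Set α} → ¬ ¬ Q → Q
    absorbing⇒stable {Q} ¬¬q with absorbing (collapseIf B Q) nontrivial b
      where
      nontrivial : ¬ IsIdentity (collapseIf B Q)
      nontrivial isId = ¬¬q λ q → b≉A a∈A (isId b a (inj₂ q))
    ... | _ , c∈A , inj₁ b≈c = contradiction b≈c (b≉A c∈A)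
    ... | _ , _   , inj₂ q   = q

    absorbing⇒dec : (P : Set α) → Dec P
    absorbing⇒dec P = absorbing⇒stable ¬¬-excluded-middle

  module _ {B : Algebra 𝑆 α} (A : Subuniverse B) (absorbing : Absorbing B A)
           (ψ : Congruence (SubAlg B A)) where
    private
      module ψ = IsEquivalence (rel-equiv ψ)

    module _ (θ : Congruence B) (θ≉id : ¬ IsIdentity θ) (θ⊆ψ : restrict A θ ⊆ᶜ ψ) where
      private
        module θ = IsEquivalence (rel-equiv θ)

        toA : Carrier B → Carrier (SubAlg B A)
        toA x = proj₁ (absorbing θ θ≉id x) , proj₁ (proj₂ (absorbing θ θ≉id x))

        θ-toA : ∀ x → rel θ x (proj₁ (toA x))
        θ-toA x = proj₂ (proj₂ (absorbing θ θ≉id x))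

      retract-resp : ∀ {x y} → rel θ x y → rel ψ (toA x) (toA y)
      retract-resp {x} {y} xθy = θ⊆ψ (θ.trans (θ.sym (θ-toA x)) (θ.trans xθy (θ-toA y)))

      retract : Hom B (SubAlg B A / ψ)
      retract = record
        { fun      = toA
        ; fun-cong = retract-resp ∘ ≈⊆rel θ
        ; fun-op   = λ f xs →
            θ⊆ψ (θ.trans (θ.sym (θ-toA (op B f xs))) (compat θ f (θ-toA ∘ xs)))
        }

      retract-on-A : ∀ a → rel ψ (fun retract (proj₁ a)) a
      retract-on-A a = θ⊆ψ (θ.sym (θ-toA (proj₁ a)))

    Join⊆ψ : ∀ {ρ} {K : Pred (Algebra 𝑆 α) ρ} → Epic K B A → SubAlg B A / ψ ∈ K →
             (θ₁ θ₂ : Congruence B) → ¬ IsIdentity θ₁ → ¬ IsIdentity θ₂ →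
             restrict A θ₁ ⊆ᶜ ψ → restrict A θ₂ ⊆ᶜ ψ →
             ∀ a a′ → Join B θ₁ θ₂ (proj₁ a) (proj₁ a′) → rel ψ a a′
    Join⊆ψ epic Q∈K θ₁ θ₂ θ₁≉id θ₂≉id θ₁⊆ψ θ₂⊆ψ a a′ J =
      ψ.trans (ψ.sym (retract-on-A θ₁ θ₁≉id θ₁⊆ψ a))
        (ψ.trans (J (kernel G₁) (retract-resp θ₁ θ₁≉id θ₁⊆ψ) θ₂⊆ker)
                 (retract-on-A θ₁ θ₁≉id θ₁⊆ψ a′))
      where
      G₁ = retract θ₁ θ₁≉id θ₁⊆ψ
      G₂ = retract θ₂ θ₂≉id θ₂⊆ψ

      G₁≈G₂ : ∀ x → rel ψ (fun G₁ x) (fun G₂ x)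
      G₁≈G₂ = epic _ Q∈K G₁ G₂ λ x x∈A →
        ψ.trans (retract-on-A θ₁ θ₁≉id θ₁⊆ψ (x , x∈A))
                (ψ.sym (retract-on-A θ₂ θ₂≉id θ₂⊆ψ (x , x∈A)))

      θ₂⊆ker : θ₂ ⊆ᶜ kernel G₁
      θ₂⊆ker {x} {y} xθy =
        ψ.trans (G₁≈G₂ x) (ψ.trans (retract-resp θ₂ θ₂≉id θ₂⊆ψ xθy) (ψ.sym (G₁≈G₂ y)))

  Join-identityˡ : (B : Algebra 𝑆 α) (θ₁ θ₂ : Congruence B) → IsIdentity θ₁ →
                   ∀ {x y} → Join B θ₁ θ₂ x y → rel θ₂ x y
  Join-identityˡ B θ₁ θ₂ isId J = J θ₂ (λ {x} {y} → ≈⊆rel θ₂ ∘ isId x y) id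

  Join-identityʳ : (B : Algebra 𝑆 α) (θ₁ θ₂ : Congruence B) → IsIdentity θ₂ →
                   ∀ {x y} → Join B θ₁ θ₂ x y → rel θ₁ x y
  Join-identityʳ B θ₁ θ₂ isId J = J θ₁ id (λ {x} {y} → ≈⊆rel θ₁ ∘ isId x y)

  Join-restrict⇒Join : {B : Algebra 𝑆 α} (A : Subuniverse B) (θ₁ θ₂ : Congruence B) →
                       ∀ a a′ → Join (SubAlg B A) (restrict A θ₁) (restrict A θ₂) a a′ →
                       Join B θ₁ θ₂ (proj₁ a) (proj₁ a′)
  Join-restrict⇒Join A θ₁ θ₂ a a′ J φ θ₁⊆φ θ₂⊆φ = J (restrict A φ) θ₁⊆φ θ₂⊆φ

proposition5p7 : ∀ {α ρ : Level} (𝑆 : Signature) (K : Pred (Algebra 𝑆 α) ρ) → IsVariety K →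
    (B : Algebra 𝑆 α) → B ∈ K → (A : Subuniverse B) → FullyEpic K B A →
    (θ₁ θ₂ : Congruence B) → (a a′ : Carrier (SubAlg B A)) →
    (Join B θ₁ θ₂ (proj₁ a) (proj₁ a′) ⇔ Join (SubAlg B A) (restrict A θ₁) (restrict A θ₂) a a′)
proposition5p7 {α} 𝑆 K V B B∈K A (epic , (b , b∉A) , _ , absorbing) θ₁ θ₂ a a′ =
  mk⇔ Join⇒Join-restrict (Join-restrict⇒Join A θ₁ θ₂ a a′)
  where
  decide : (P : Set α) → Dec P
  decide = absorbing⇒dec A (proj₂ a) b∉A absorbing

  Join⇒Join-restrict : Join B θ₁ θ₂ (proj₁ a) (proj₁ a′) →
                       Join (SubAlg B A) (restrict A θ₁) (restrict A θ₂) a a′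
  Join⇒Join-restrict J ψ θ₁⊆ψ θ₂⊆ψ with decide (IsIdentity θ₁) | decide (IsIdentity θ₂)
  ... | yes θ₁≈id | _         = θ₂⊆ψ (Join-identityˡ B θ₁ θ₂ θ₁≈id J)
  ... | no _      | yes θ₂≈id = θ₁⊆ψ (Join-identityʳ B θ₁ θ₂ θ₂≈id J)
  ... | no θ₁≉id  | no θ₂≉id  =
    Join⊆ψ A absorbing ψ epic (quotient∈ V (SubAlg∈ V B∈K A) ψ)
           θ₁ θ₂ θ₁≉id θ₂≉id θ₁⊆ψ θ₂⊆ψ a a′ J
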